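{- A graph class $\mathcal{C}$ is near-uniform if and only if $\mathcal{C}$ is near-covered.
   Context: All graphs are finite, simple and undirected. For a graph $G$ and $v\in V(G)$, $N(v)=\{w\in V(G)\mid \{v,w\}\in E(G)\}$ (so $v\notin N(v)$); $\mathop{\bigtriangleup}$ denotes symmetric difference. For $k\in\mathbb N$ (with $0\in\mathbb N$), the near-$k$-twin relation of $G$ is the relation $\rho_k$ on $V(G)$ with $(u,v)\in\rho_k$ iff $|N(u)\mathop{\bigtriangleup} N(v)|\le k$; $u,v$ are then called near-$k$-twins. A graph $G$ is $(k_0,p)$-near-uniform if there exists $k\le k_0$ such that $\rho_k$ is an equivalence relation on $V(G)$ with at most $p$ classes; a class $\mathcal{C}$ is $(k_0,p)$-near-uniform if every member is, and near-uniform if it is $(k_0,p)$-near-uniform for some integers $k_0,p$. A graph $G$ is $(\ell,q)$-near-covered if there exist vertices $v_1,\dots,v_q\in V(G)$ such that every $u\in V(G)$ is a near-$\ell$-twin of at least one of $v_1,\dots,v_q$; a class $\mathcal{C}$ is $(\ell,q)$-near-covered if every member of $\mathcal{C}$ with at least $q$ vertices is $(\ell,q)$-near-covered, and near-covered if it is $(\ell,q)$-near-covered for some integers $\ell,q$. -}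

module Defs where

open import Level using (Level)
open import Data.Bool using (Bool; true; false; _xor_)
open import Data.Nat using (ℕ; _≤_)
open import Data.Fin using (Fin)
open import Data.Fin.Subset using (Subset; ∣_∣)
open import Data.Vec using (tabulate; zipWith)
open import Data.Product using (Σ; ∃; ∃-syntax; _×_)
open import Relation.Binary.PropositionalEquality using (_≡_)
open import Relation.Binary.Structures using (IsEquivalence)

record Graph : Set where
  field
    n      : ℕ
    adj    : Fin n → Fin n → Bool
    sym    : ∀ u v → adj u v ≡ adj v u
    irrefl : ∀ v → adj v v ≡ false

open Graph public

V : Graph → Set
V G = Fin (n G)

N : (G : Graph) → V G → Subset (n G)
N G v = tabulate (adj G v)

_△_ : ∀ {m} → Subset m → Subset m → Subset m
_△_ = zipWith _xor_

ρ : (G : Graph) → ℕ → V G → V G → Set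
ρ G k u v = ∣ N G u △ N G v ∣ ≤ k

-- ρ_k is an equivalence relation with at most p classes
-- (the classes inject into Fin p: f u ≡ f v iff ρ_k u v).
AtMostClasses : (G : Graph) → ℕ → ℕ → Set
AtMostClasses G k p =
  IsEquivalence (ρ G k) ×
  Σ (V G → Fin p) λ f → ∀ u v → (ρ G k u v → f u ≡ f v) × (f u ≡ f v → ρ G k u v)

NearUniformGraph : ℕ → ℕ → Graph → Set
NearUniformGraph k₀ p G = ∃[ k ] (k ≤ k₀ × AtMostClasses G k p)

NearCoveredGraph : ℕ → ℕ → Graph → Set
NearCoveredGraph ℓ q G = Σ (Fin q → V G) λ vs → ∀ u → ∃[ i ] ρ G ℓ u (vs i)

module _ {a : Level} (C : Graph → Set a) where

  NearUniformClass : ℕ → ℕ → Set a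
  NearUniformClass k₀ p = ∀ G → C G → NearUniformGraph k₀ p G

  NearUniform : Set a
  NearUniform = ∃[ k₀ ] ∃[ p ] NearUniformClass k₀ p

  NearCoveredClass : ℕ → ℕ → Set a
  NearCoveredClass ℓ q = ∀ G → C G → q ≤ n G → NearCoveredGraph ℓ q G

  NearCovered : Set a
  NearCovered = ∃[ ℓ ] ∃[ q ] NearCoveredClass ℓ q

-- Neighbourhoods form a finite metric space under the size of the symmetric
-- difference, and ρ_k relates vertices at distance at most k.  A partition into
-- p near-k-twin classes is covered by one representative per class.  Conversely,
-- given q centres covering everything within distance ℓ, the q² distances
-- between centres leave a gap (b, 2b + 4ℓ] for some b bounded in terms of ℓ and
-- q only.  Then "within distance b" is an equivalence relation on the centres,
-- and two vertices are within distance ℓ + b + ℓ exactly when their centres are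
-- within distance b, so ρ_{ℓ+b+ℓ} has at most q classes.  Graphs with fewer
-- than q vertices are handled trivially by ρ_n, which relates all vertices.
module Submission where

open import Defs
open import Level using (Level)
open import Function using (_∘_)
open import Function.Bundles using (_⇔_; mk⇔; Equivalence)
import Function.Properties.Equivalence as ⇔
open import Data.Bool using (true; false; _xor_)
open import Data.Bool.Properties using (xor-comm)
open import Data.Nat using (ℕ; zero; suc; _+_; _*_; _≤_; _<_; z≤n; s≤s; _≤?_)
open import Data.Nat.Properties
  using (≤-refl; ≤-trans; ≤-reflexive; <⇒≤; <⇒≱; ≰⇒>; n≤1+n; m≤n⇒m≤1+n; m≤m+n; m≤n+m;
         +-suc; +-mono-≤; +-monoˡ-≤; +-monoʳ-≤)
open import Data.Nat.Tactic.RingSolver using (solve-∀)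
open import Data.Fin as Fin using (Fin; zero; suc; fromℕ<; combine; remQuot)
import Data.Fin.Properties as Finₚ
open import Data.Fin.Subset using (Subset; ∣_∣)
open import Data.Fin.Subset.Properties using (∣p∣≤n)
open import Data.Vec using ([]; _∷_)
open import Data.Vec.Properties using (zipWith-comm)
open import Data.Product using (∃; ∃-syntax; _×_; _,_; proj₁; proj₂; uncurry)
open import Data.Sum using (_⊎_; inj₁; inj₂)
open import Relation.Nullary using (yes; no; contradiction)
open import Relation.Unary using (Pred; Decidable)
open import Relation.Binary using (Rel; IsEquivalence; IsDecEquivalence)
open import Relation.Binary.PropositionalEquality as ≡ using (_≡_; refl; cong)

dist : ∀ {m} → Subset m → Subset m → ℕ
dist x y = ∣ x △ y ∣

dist-self : ∀ {m} (x : Subset m) → dist x x ≡ 0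
dist-self []          = refl
dist-self (true ∷ x)  = dist-self x
dist-self (false ∷ x) = dist-self x

dist-sym : ∀ {m} (x y : Subset m) → dist x y ≡ dist y x
dist-sym x y = cong ∣_∣ (zipWith-comm xor-comm x y)

xor-cancel : ∀ a b c → (a xor b) xor (b xor c) ≡ a xor c
xor-cancel true  true  c = refl
xor-cancel true  false c = refl
xor-cancel false true  true  = refl
xor-cancel false true  false = refl
xor-cancel false false c = refl

△-cancel : ∀ {m} (x y z : Subset m) → (x △ y) △ (y △ z) ≡ x △ z
△-cancel []      []      []      = refl
△-cancel (a ∷ x) (b ∷ y) (c ∷ z) = ≡.cong₂ _∷_ (xor-cancel a b c) (△-cancel x y z)

∣p△q∣≤∣p∣+∣q∣ : ∀ {m} (p q : Subset m) → ∣ p △ q ∣ ≤ ∣ p ∣ + ∣ q ∣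
∣p△q∣≤∣p∣+∣q∣ []          []          = z≤n
∣p△q∣≤∣p∣+∣q∣ (true ∷ p)  (true ∷ q)  =
  m≤n⇒m≤1+n (≤-trans (∣p△q∣≤∣p∣+∣q∣ p q) (+-monoʳ-≤ ∣ p ∣ (n≤1+n ∣ q ∣)))
∣p△q∣≤∣p∣+∣q∣ (true ∷ p)  (false ∷ q) = s≤s (∣p△q∣≤∣p∣+∣q∣ p q)
∣p△q∣≤∣p∣+∣q∣ (false ∷ p) (true ∷ q)  =
  ≤-trans (s≤s (∣p△q∣≤∣p∣+∣q∣ p q)) (≤-reflexive (≡.sym (+-suc ∣ p ∣ ∣ q ∣)))
∣p△q∣≤∣p∣+∣q∣ (false ∷ p) (false ∷ q) = ∣p△q∣≤∣p∣+∣q∣ p q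

dist-triangle : ∀ {m} (x y z : Subset m) → dist x z ≤ dist x y + dist y z
dist-triangle x y z =
  ≡.subst (_≤ dist x y + dist y z) (cong ∣_∣ (△-cancel x y z))
          (∣p△q∣≤∣p∣+∣q∣ (x △ y) (y △ z))

dist-triangle₃ : ∀ {m} (x y z w : Subset m) →
                 dist x w ≤ dist x y + dist y z + dist z w
dist-triangle₃ x y z w =
  ≤-trans (dist-triangle x z w) (+-monoˡ-≤ (dist z w) (dist-triangle x y z))

module Gap (F : ℕ → ℕ) (F-inflationary : ∀ b → b ≤ F b)
           (F-monotone : ∀ {a b} → a ≤ b → F a ≤ F b) where

  bound : ℕ → ℕ → ℕ
  bound zero    a = a
  bound (suc m) a = bound m (F (bound m a))

  bound-inflationary : ∀ m a → a ≤ bound m a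
  bound-inflationary zero    a = ≤-refl
  bound-inflationary (suc m) a =
    ≤-trans (bound-inflationary m a)
      (≤-trans (F-inflationary (bound m a)) (bound-inflationary m (F (bound m a))))

  bound-monotone : ∀ m {a a′} → a ≤ a′ → bound m a ≤ bound m a′
  bound-monotone zero    a≤a′ = a≤a′
  bound-monotone (suc m) a≤a′ = bound-monotone m (F-monotone (bound-monotone m a≤a′))

  bound-step : ∀ m a → bound m a ≤ bound (suc m) a
  bound-step m a =
    ≤-trans (F-inflationary (bound m a)) (bound-inflationary m (F (bound m a)))

  -- If g 0 falls into the gap (b, F b] left by the other values, search again
  -- above F b, where g 0 lies below the threshold.
  gap : ∀ m (g : Fin m → ℕ) a →
        ∃[ b ] a ≤ b × b ≤ bound m a × (∀ i → g i ≤ b ⊎ F b < g i)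
  gap zero    g a = a , ≤-refl , ≤-refl , λ ()
  gap (suc m) g a with gap m (g ∘ suc) a
  ... | b , a≤b , b≤ , sep with g zero ≤? b | g zero ≤? F b
  ...   | yes below | _ =
    b , a≤b , ≤-trans b≤ (bound-step m a) , Finₚ.∀-cons (inj₁ below) sep
  ...   | no _ | no above =
    b , a≤b , ≤-trans b≤ (bound-step m a) , Finₚ.∀-cons (inj₂ (≰⇒> above)) sep
  ...   | no _ | yes inGap with gap m (g ∘ suc) (F b)
  ...     | b′ , Fb≤b′ , b′≤ , sep′ =
    b′ , ≤-trans a≤b (≤-trans (F-inflationary b) Fb≤b′)
       , ≤-trans b′≤ (bound-monotone m (F-monotone b≤))
       , Finₚ.∀-cons (inj₁ (≤-trans inGap Fb≤b′)) sep′

  gap² : ∀ q (g : Fin q → Fin q → ℕ) a →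
         ∃[ b ] b ≤ bound (q * q) a × (∀ i j → g i j ≤ b ⊎ F b < g i j)
  gap² q g a with gap (q * q) (uncurry g ∘ remQuot q) a
  ... | b , _ , b≤ , sep = b , b≤ , λ i j →
    ≡.subst (λ (i , j) → g i j ≤ b ⊎ F b < g i j) (Finₚ.remQuot-combine i j) (sep (combine i j))

leastWitness : ∀ {m p} {P : Pred (Fin m) p} → Decidable P → ∃ P →
               ∃ λ i → P i × (∀ {j} → P j → i Fin.≤ j)
leastWitness P? (zero , p₀) = zero , p₀ , λ _ → z≤n
leastWitness P? (suc i , pᵢ) with P? zero
... | yes p₀ = zero , p₀ , λ _ → z≤n
... | no ¬p₀ with leastWitness (P? ∘ suc) (i , pᵢ)
...   | j , pⱼ , least = suc j , pⱼ , λ { {zero} p₀ → contradiction p₀ ¬p₀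
                                       ; {suc k} pₖ → s≤s (least pₖ) }

module ClassIndex {m r} {_≈_ : Rel (Fin m) r} (≈-isDecEquivalence : IsDecEquivalence _≈_) where

  open IsDecEquivalence ≈-isDecEquivalence
    using (_≟_) renaming (refl to ≈-refl; sym to ≈-sym; trans to ≈-trans)

  classIndex : Fin m → Fin m
  classIndex i = proj₁ (leastWitness (_≟ i) (i , ≈-refl))

  private
    member : ∀ i → classIndex i ≈ i
    member i = proj₁ (proj₂ (leastWitness (_≟ i) (i , ≈-refl)))

    least : ∀ i {j} → j ≈ i → classIndex i Fin.≤ j
    least i = proj₂ (proj₂ (leastWitness (_≟ i) (i , ≈-refl)))

  classIndex-correct : ∀ i j → i ≈ j ⇔ classIndex i ≡ classIndex j
  classIndex-correct i j = mk⇔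
    (λ i≈j → Finₚ.≤-antisym (least i (≈-trans (member j) (≈-sym i≈j)))
                            (least j (≈-trans (member i) i≈j)))
    (λ same → ≈-trans (≈-sym (member i)) (≡.subst (_≈ j) (≡.sym same) (member j)))

δ : (G : Graph) → V G → V G → ℕ
δ G u v = dist (N G u) (N G v)

classes-fromKernel : ∀ (G : Graph) {k p} (f : V G → Fin p) →
                     (∀ u v → ρ G k u v ⇔ f u ≡ f v) → AtMostClasses G k p
classes-fromKernel G f kernel =
  isEquivalence , f , λ u v → Equivalence.to (kernel u v) , Equivalence.from (kernel u v)
  where
  isEquivalence : IsEquivalence (ρ G _)
  isEquivalence = record
    { refl  = λ {u} → Equivalence.from (kernel u u) refl
    ; sym   = λ {u} {v} r → Equivalence.from (kernel v u) (≡.sym (Equivalence.to (kernel u v) r))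
    ; trans = λ {u} {v} {w} r s → Equivalence.from (kernel u w)
                (≡.trans (Equivalence.to (kernel u v) r) (Equivalence.to (kernel v w) s))
    }

nearUniform⇒nearCovered : ∀ {k₀ p} (G : Graph) → p ≤ n G →
                          NearUniformGraph k₀ p G → NearCoveredGraph k₀ p G
nearUniform⇒nearCovered {p = p} G p≤n (k , k≤k₀ , _ , f , kernel) =
  proj₁ ∘ representative , λ u →
    f u , ≤-trans (proj₂ (kernel u _) (≡.sym (proj₂ (representative (f u)) refl))) k≤k₀
  where
  representative : (i : Fin p) → ∃ λ w → ∀ {u} → f u ≡ i → f w ≡ i
  representative i with Finₚ.any? (λ u → f u Fin.≟ i)
  ... | yes (w , fw≡i) = w , λ _ → fw≡i
  ... | no  empty      = fromℕ< (≤-trans (Finₚ.toℕ<n i) p≤n) ,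
                         λ {u} fu≡i → contradiction (u , fu≡i) empty

few-vertices : ∀ (G : Graph) {q} → n G < q → AtMostClasses G (n G) q
few-vertices G {suc q} _ =
  classes-fromKernel G (λ _ → zero) λ u v → mk⇔ (λ _ → refl) (λ _ → ∣p∣≤n (N G u △ N G v))

stretch : ℕ → ℕ → ℕ
stretch ℓ b = b + (b + 4 * ℓ)

stretch-inflationary : ∀ ℓ b → b ≤ stretch ℓ b
stretch-inflationary ℓ b = m≤m+n b _

stretch-monotone : ∀ ℓ {a b} → a ≤ b → stretch ℓ a ≤ stretch ℓ b
stretch-monotone ℓ a≤b = +-mono-≤ a≤b (+-monoˡ-≤ (4 * ℓ) a≤b)

b+b≤stretch : ∀ ℓ b → b + b ≤ stretch ℓ b
b+b≤stretch ℓ b = +-monoʳ-≤ b (m≤m+n b _)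

ℓ+radius+ℓ≤stretch : ∀ ℓ b → ℓ + (ℓ + b + ℓ) + ℓ ≤ stretch ℓ b
ℓ+radius+ℓ≤stretch ℓ b = ≤-trans (≤-reflexive (rearrange ℓ b)) (m≤n+m _ b)
  where
  rearrange : ∀ ℓ b → ℓ + (ℓ + b + ℓ) + ℓ ≡ b + 4 * ℓ
  rearrange = solve-∀

module StretchGap (ℓ : ℕ) = Gap (stretch ℓ) (stretch-inflationary ℓ) (stretch-monotone ℓ)

module FromCentres (G : Graph) {ℓ q : ℕ} (centre : Fin q → V G)
                   (covered : ∀ u → ∃[ i ] ρ G ℓ u (centre i)) (b : ℕ)
                   (gapped : ∀ i j → δ G (centre i) (centre j) ≤ b
                                   ⊎ stretch ℓ b < δ G (centre i) (centre j)) where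

  nearest : V G → Fin q
  nearest u = proj₁ (covered u)

  near-nearest : ∀ u → δ G u (centre (nearest u)) ≤ ℓ
  near-nearest u = proj₂ (covered u)

  nearest-near : ∀ u → δ G (centre (nearest u)) u ≤ ℓ
  nearest-near u = ≡.subst (_≤ ℓ) (dist-sym (N G u) _) (near-nearest u)

  _≈_ : Rel (Fin q) _
  i ≈ j = δ G (centre i) (centre j) ≤ b

  ≈-fromStretch : ∀ {i j} → δ G (centre i) (centre j) ≤ stretch ℓ b → i ≈ j
  ≈-fromStretch {i} {j} ≤stretch with gapped i j
  ... | inj₁ i≈j  = i≈j
  ... | inj₂ far = contradiction ≤stretch (<⇒≱ far)

  ≈-isDecEquivalence : IsDecEquivalence _≈_
  ≈-isDecEquivalence = record
    { isEquivalence = record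
      { refl  = λ {i} → ≤-trans (≤-reflexive (dist-self (N G (centre i)))) z≤n
      ; sym   = λ {i} {j} → ≡.subst (_≤ b) (dist-sym (N G (centre i)) _)
      ; trans = λ {i} {j} {l} i≈j j≈l → ≈-fromStretch
          (≤-trans (dist-triangle (N G (centre i)) (N G (centre j)) _)
                   (≤-trans (+-mono-≤ i≈j j≈l) (b+b≤stretch ℓ b)))
      }
    ; _≟_ = λ i j → δ G (centre i) (centre j) ≤? b
    }

  ρ⇔≈ : ∀ u v → ρ G (ℓ + b + ℓ) u v ⇔ nearest u ≈ nearest v
  ρ⇔≈ u v = mk⇔
    (λ uv → ≈-fromStretch (≤-trans (dist-triangle₃ (N G (centre (nearest u))) (N G u) (N G v) _)
      (≤-trans (+-mono-≤ (+-mono-≤ (nearest-near u) uv) (near-nearest v))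
               (ℓ+radius+ℓ≤stretch ℓ b))))
    (λ close → ≤-trans (dist-triangle₃ (N G u) (N G (centre (nearest u))) _ (N G v))
      (+-mono-≤ (+-mono-≤ (near-nearest u) close) (nearest-near v)))

  open ClassIndex ≈-isDecEquivalence

  classes : AtMostClasses G (ℓ + b + ℓ) q
  classes = classes-fromKernel G (classIndex ∘ nearest) λ u v →
    ⇔.trans (ρ⇔≈ u v) (classIndex-correct (nearest u) (nearest v))

centreBound : ℕ → ℕ → ℕ
centreBound ℓ q = StretchGap.bound ℓ (q * q) 0

nearCovered⇒nearUniform : ∀ {ℓ q} (G : Graph) → (q ≤ n G → NearCoveredGraph ℓ q G) →
                          NearUniformGraph (ℓ + centreBound ℓ q + ℓ + q) q G
nearCovered⇒nearUniform {ℓ} {q} G cover with q ≤? n G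
... | no q≰n =
  n G , ≤-trans (<⇒≤ (≰⇒> q≰n)) (m≤n+m q _) , few-vertices G (≰⇒> q≰n)
... | yes q≤n with cover q≤n
...   | centre , covered with StretchGap.gap² ℓ q (λ i j → δ G (centre i) (centre j)) 0
...     | b , b≤ , gapped =
  ℓ + b + ℓ , ≤-trans (+-monoˡ-≤ ℓ (+-monoʳ-≤ ℓ b≤)) (m≤m+n _ q) ,
  FromCentres.classes G centre covered b gapped

lemma6 : ∀ {a : Level} (C : Graph → Set a) → NearUniform C ⇔ NearCovered C
lemma6 C = mk⇔
  (λ (k₀ , p , uniform) → k₀ , p , λ G G∈C p≤n →
     nearUniform⇒nearCovered G p≤n (uniform G G∈C))
  (λ (ℓ , q , covered) → _ , q , λ G G∈C →
     nearCovered⇒nearUniform G (covered G G∈C))
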